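{- The action of $\mathrm{OSp}(1|2)$ on $\mathcal{A}^{2|1}_+$ (by matrix-vector multiplication) is transitive.
   Context: $\mathcal{A}$ is a super-commutative algebra and $\mathcal{A}^{2|1}$ the free module of vectors $(x,y|\phi)$ with $x,y$ even and $\phi$ odd. $\mathcal{A}^{2|1}_+$ is the set of vectors $(x,y|\phi)$ with non-zero bodies, i.e. $x\neq0$ or $y\neq0$ (in the sense of nonzero body, so that $x$ or $y$ is invertible). $\mathrm{OSp}(1|2)$ is the group of $2|1\times2|1$ supermatrices $g$ over $\mathcal{A}$ with Berezinian $1$ and $g^{\mathrm{st}}Jg=J$, where $J=\begin{pmatrix}0&1&0\\-1&0&0\\0&0&1\end{pmatrix}$ and $\mathrm{st}$ is the supertranspose. -}

module Defs where

open import Level using (Level; _⊔_; suc)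
open import Data.Product using (Σ; _×_; ∃; ∃-syntax)
open import Data.Sum using (_⊎_)
open import Algebra.Bundles using (CommutativeRing)
open import Algebra.Module.Bundles using (Module)

-- A super-commutative algebra A = A₀ ⊕ A₁ :
--   A₀ (even part) is a commutative ring,
--   A₁ (odd part) is an A₀-module,
--   the product of two odd elements is an even element, bilinear,
--   skew (φψ = -ψφ, φφ = 0) and associative ((φψ)χ = φ(ψχ) = (ψχ)φ).
-- (Even elements are central; products even·odd are the module action.)

record SuperCommAlgebra (c ℓ m ℓm : Level) : Set (suc (c ⊔ ℓ ⊔ m ⊔ ℓm)) where
  field
    even : CommutativeRing c ℓ
    odd  : Module even m ℓm
  open CommutativeRing even public
  open Module odd public
    using (Carrierᴹ; _≈ᴹ_; _+ᴹ_; _*ₗ_; 0ᴹ; -ᴹ_)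
  infixl 7 _·_
  field
    _·_        : Carrierᴹ → Carrierᴹ → Carrier
    ·-cong     : ∀ {φ φ' ψ ψ'} → φ ≈ᴹ φ' → ψ ≈ᴹ ψ' → (φ · ψ) ≈ (φ' · ψ')
    ·-distribʳ : ∀ φ ψ χ → ((φ +ᴹ ψ) · χ) ≈ ((φ · χ) + (ψ · χ))
    ·-distribˡ : ∀ φ ψ χ → (χ · (φ +ᴹ ψ)) ≈ ((χ · φ) + (χ · ψ))
    ·-scalarˡ  : ∀ r φ ψ → ((r *ₗ φ) · ψ) ≈ (r * (φ · ψ))
    ·-scalarʳ  : ∀ r φ ψ → (φ · (r *ₗ ψ)) ≈ (r * (φ · ψ))
    ·-skew     : ∀ φ ψ → (φ · ψ) ≈ (- (ψ · φ))
    ·-square   : ∀ φ → (φ · φ) ≈ 0#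
    ·-assoc    : ∀ φ ψ χ → ((φ · ψ) *ₗ χ) ≈ᴹ ((ψ · χ) *ₗ φ)

module OSp12 {c ℓ m ℓm : Level} (𝒜 : SuperCommAlgebra c ℓ m ℓm) where
  open SuperCommAlgebra 𝒜

  record Vec21 : Set (c ⊔ m) where
    constructor ⟨_,_∣_⟩
    field
      vx vy : Carrier
      vφ    : Carrierᴹ
  open Vec21 public

  _≈V_ : Vec21 → Vec21 → Set (ℓ ⊔ ℓm)
  u ≈V v = (vx u ≈ vx v) × (vy u ≈ vy v) × (vφ u ≈ᴹ vφ v)

  Invertible : Carrier → Set (c ⊔ ℓ)
  Invertible x = ∃[ z ] (x * z ≈ 1#)

  -- 𝒜^{2|1}_+ : x or y has non-zero body, i.e. x or y is invertible
  InPlus : Vec21 → Set (c ⊔ ℓ)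
  InPlus v = Invertible (vx v) ⊎ Invertible (vy v)

  -- even 2|1 × 2|1 supermatrices
  --   ( a11 a12 | b1 )
  --   ( a21 a22 | b2 )
  --   ( c1  c2  | d  )
  -- with aij, d even and bi, cj odd.
  record SMat : Set (c ⊔ m) where
    field
      a11 a12 a21 a22 d : Carrier
      b1 b2 c1 c2       : Carrierᴹ
  open SMat public

  _≈M_ : SMat → SMat → Set (ℓ ⊔ ℓm)
  M ≈M N = (a11 M ≈ a11 N) × (a12 M ≈ a12 N) × (a21 M ≈ a21 N)
         × (a22 M ≈ a22 N) × (d M ≈ d N)
         × (b1 M ≈ᴹ b1 N) × (b2 M ≈ᴹ b2 N)
         × (c1 M ≈ᴹ c1 N) × (c2 M ≈ᴹ c2 N)

  _⊙_ : SMat → SMat → SMat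
  M ⊙ N = record
    { a11 = (a11 M * a11 N) + (a12 M * a21 N) + (b1 M · c1 N)
    ; a12 = (a11 M * a12 N) + (a12 M * a22 N) + (b1 M · c2 N)
    ; a21 = (a21 M * a11 N) + (a22 M * a21 N) + (b2 M · c1 N)
    ; a22 = (a21 M * a12 N) + (a22 M * a22 N) + (b2 M · c2 N)
    ; b1  = (a11 M *ₗ b1 N) +ᴹ (a12 M *ₗ b2 N) +ᴹ (d N *ₗ b1 M)
    ; b2  = (a21 M *ₗ b1 N) +ᴹ (a22 M *ₗ b2 N) +ᴹ (d N *ₗ b2 M)
    ; c1  = (a11 N *ₗ c1 M) +ᴹ (a21 N *ₗ c2 M) +ᴹ (d M *ₗ c1 N)
    ; c2  = (a12 N *ₗ c1 M) +ᴹ (a22 N *ₗ c2 M) +ᴹ (d M *ₗ c2 N)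
    ; d   = (c1 M · b1 N) + (c2 M · b2 N) + (d M * d N)
    }

  -- supertranspose of an even supermatrix:
  --   ( A B ; C D )^st = ( A^t C^t ; -B^t D^t )
  st : SMat → SMat
  st M = record
    { a11 = a11 M ; a12 = a21 M ; a21 = a12 M ; a22 = a22 M
    ; b1 = c1 M ; b2 = c2 M
    ; c1 = -ᴹ (b1 M) ; c2 = -ᴹ (b2 M)
    ; d = d M
    }

  J : SMat
  J = record
    { a11 = 0# ; a12 = 1# ; a21 = - 1# ; a22 = 0#
    ; b1 = 0ᴹ ; b2 = 0ᴹ ; c1 = 0ᴹ ; c2 = 0ᴹ
    ; d = 1#
    }

  -- Berezinian Ber(M) = det(A - B D⁻¹ C) · D⁻¹, computed with a given
  -- inverse dinv of the (1×1, even) block D.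
  Ber : SMat → Carrier → Carrier
  Ber M dinv =
    ((a11 M - dinv * (b1 M · c1 M)) * (a22 M - dinv * (b2 M · c2 M))
      - (a12 M - dinv * (b1 M · c2 M)) * (a21 M - dinv * (b2 M · c1 M)))
    * dinv

  -- g ∈ OSp(1|2): Ber g = 1 (the Berezinian being defined, i.e. D
  -- invertible) and g^st J g = J.
  IsOSp : SMat → Set (c ⊔ ℓ ⊔ ℓm)
  IsOSp g = (∃[ dinv ] ((d g * dinv ≈ 1#) × (Ber g dinv ≈ 1#)))
          × ((st g ⊙ (J ⊙ g)) ≈M J)

  _▷_ : SMat → Vec21 → Vec21
  M ▷ v = ⟨ (a11 M * vx v) + (a12 M * vy v) + (b1 M · vφ v)
          , (a21 M * vx v) + (a22 M * vy v) + (b2 M · vφ v)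
          ∣ (vx v *ₗ c1 M) +ᴹ (vy v *ₗ c2 M) +ᴹ (d M *ₗ vφ v) ⟩

  TransitiveOnPlus : Set (c ⊔ ℓ ⊔ m ⊔ ℓm)
  TransitiveOnPlus = ∀ (u v : Vec21) → InPlus u → InPlus v →
    ∃[ g ] (IsOSp g × ((g ▷ u) ≈V v))

-- Write u = (x, y | φ), v = (x′, y′ | φ′) and β = φ′ − φ. We look for g ∈ OSp(1|2) whose odd
-- entries are all multiples of β. Since β² = 0, every product of two odd entries vanishes, so
-- Ber g = det A for the even block A, and g^st J g = J reduces to det A = 1 together with a
-- linear formula for the odd row in terms of the odd column (s β, t β) and A. The odd component
-- of g u is then (x k₁ + y k₂) β + φ, so g u = v amounts to A (x, y) = (v₁, v₂) := (x′, y′) − (s, t)(β · φ)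
-- and x k₁ + y k₂ = 1. As u and v lie in 𝒜^{2|1}_+, there are p, q with p x + q y = 1 and
-- s, t with s y′ − t x′ = 1; the A determined by A (x, y) = (v₁, v₂), A (q, −p) = (s, t) has
-- determinant s v₂ − t v₁ = 1, and x k₁ + y k₂ = 1 follows by the same computation.

module Submission where

open import Defs
open import Level using (Level; 0ℓ; _⊔_)
open import Algebra.Bundles using (CommutativeRing; RawRing)
open import Algebra.Module.Bundles using (Module)
open import Algebra.Solver.Ring.AlmostCommutativeRing
  using (fromCommutativeRing; _-Raw-AlmostCommutative⟶_)
open import Data.Maybe using (Maybe; just; nothing)
open import Data.Nat as ℕ using (ℕ)
open import Data.Product using (_×_; _,_; ∃₂; ∃-syntax)
open import Data.Sum using (inj₁; inj₂)
open import Relation.Binary.PropositionalEquality as ≡ using (_≡_)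
open import Relation.Nullary using (yes; no)

module IntegerCoefficientSolver {c ℓ} (R : CommutativeRing c ℓ) where
  open CommutativeRing R
  open import Algebra.Properties.Ring ring
    using (-‿distribˡ-*; -‿distribʳ-*; -‿involutive; -‿+-comm; ⁻¹-anti-homo‿-; -0#≈0#)
  open import Algebra.Properties.CommutativeSemigroup +-commutativeSemigroup
    using (interchange)
  open import Algebra.Properties.Semiring.Mult semiring
    using (×-homo-+; ×1-homo-*) renaming (_×_ to _×ₙ_)
  open import Relation.Binary.Reasoning.Setoid setoid

  -- The pair (m , n) stands for the integer m − n.
  ℕ²-rawRing : RawRing 0ℓ 0ℓ
  ℕ²-rawRing = record
    { Carrier = ℕ × ℕ
    ; _≈_     = _≡_
    ; _+_     = λ { (m , n) (m′ , n′) → (m ℕ.+ m′ , n ℕ.+ n′) }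
    ; _*_     = λ { (m , n) (m′ , n′) → (m ℕ.* m′ ℕ.+ n ℕ.* n′ , m ℕ.* n′ ℕ.+ n ℕ.* m′) }
    ; -_      = λ { (m , n) → (n , m) }
    ; 0#      = (0 , 0)
    ; 1#      = (1 , 0)
    }

  fromℕ : ℕ → Carrier
  fromℕ n = n ×ₙ 1#

  ⟦_⟧ℤ : ℕ × ℕ → Carrier
  ⟦ m , n ⟧ℤ = fromℕ m - fromℕ n

  [a+c]-[b+d]≈[a-b]+[c-d] : ∀ a b c d → (a + c) - (b + d) ≈ (a - b) + (c - d)
  [a+c]-[b+d]≈[a-b]+[c-d] a b c d = begin
    (a + c) - (b + d)      ≈⟨ +-congˡ (-‿+-comm b d) ⟨
    (a + c) + (- b + - d)  ≈⟨ interchange a c (- b) (- d) ⟩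
    (a - b) + (c - d)      ∎

  [ac+bd]-[ad+bc]≈[a-b][c-d] : ∀ a b c d → (a * c + b * d) - (a * d + b * c) ≈ (a - b) * (c - d)
  [ac+bd]-[ad+bc]≈[a-b][c-d] a b c d = sym (begin
    (a - b) * (c - d)                          ≈⟨ distribˡ (a - b) c (- d) ⟩
    (a - b) * c + (a - b) * - d                ≈⟨ +-cong (distribʳ c a (- b)) (distribʳ (- d) a (- b)) ⟩
    (a * c + - b * c) + (a * - d + - b * - d)  ≈⟨ +-cong (+-congˡ (-‿distribˡ-* b c))
                                                         (+-cong (-‿distribʳ-* a d) (sym -b*-d≈bd)) ⟨
    (a * c - b * c) + (- (a * d) + b * d)      ≈⟨ +-congˡ (+-comm _ _) ⟩
    (a * c - b * c) + (b * d - a * d)          ≈⟨ interchange _ _ _ _ ⟩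
    (a * c + b * d) + (- (b * c) + - (a * d))  ≈⟨ +-congˡ (+-comm _ _) ⟩
    (a * c + b * d) + (- (a * d) + - (b * c))  ≈⟨ +-congˡ (-‿+-comm _ _) ⟩
    (a * c + b * d) - (a * d + b * c)          ∎)
    where
    -b*-d≈bd : - b * - d ≈ b * d
    -b*-d≈bd = begin
      - b * - d      ≈⟨ -‿distribˡ-* b (- d) ⟨
      - (b * - d)    ≈⟨ -‿cong (-‿distribʳ-* b d) ⟨
      - - (b * d)    ≈⟨ -‿involutive (b * d) ⟩
      b * d          ∎

  a+d≈c+b⇒a-b≈c-d : ∀ a b c d → a + d ≈ c + b → a - b ≈ c - d
  a+d≈c+b⇒a-b≈c-d a b c d a+d≈c+b = begin
    a - b                ≈⟨ +-identityʳ _ ⟨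
    (a - b) + 0#         ≈⟨ +-congˡ (-‿inverseʳ d) ⟨
    (a - b) + (d - d)    ≈⟨ interchange _ _ _ _ ⟩
    (a + d) + (- b - d)  ≈⟨ +-cong a+d≈c+b (+-comm _ _) ⟩
    (c + b) + (- d - b)  ≈⟨ interchange _ _ _ _ ⟩
    (c - d) + (b - b)    ≈⟨ +-congˡ (-‿inverseʳ b) ⟩
    (c - d) + 0#         ≈⟨ +-identityʳ _ ⟩
    c - d                ∎

  ⟦⟧-homomorphism : ℕ²-rawRing -Raw-AlmostCommutative⟶ fromCommutativeRing R
  ⟦⟧-homomorphism = record
    { ⟦_⟧    = ⟦_⟧ℤ
    ; +-homo = λ { (a , b) (c , d) → trans
        (+-cong (×-homo-+ 1# a c) (-‿cong (×-homo-+ 1# b d)))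
        ([a+c]-[b+d]≈[a-b]+[c-d] (fromℕ a) (fromℕ b) (fromℕ c) (fromℕ d)) }
    ; *-homo = λ { (a , b) (c , d) → trans
        (+-cong (fromℕ-sum-of-products a c b d) (-‿cong (fromℕ-sum-of-products a d b c)))
        ([ac+bd]-[ad+bc]≈[a-b][c-d] (fromℕ a) (fromℕ b) (fromℕ c) (fromℕ d)) }
    ; -‿homo = λ { (a , b) → sym (⁻¹-anti-homo‿- (fromℕ a) (fromℕ b)) }
    ; 0-homo = -‿inverseʳ 0#
    ; 1-homo = trans (+-congʳ (+-identityʳ 1#)) (trans (+-congˡ -0#≈0#) (+-identityʳ 1#))
    }
    where
    fromℕ-sum-of-products : ∀ a b c d →
      fromℕ (a ℕ.* b ℕ.+ c ℕ.* d) ≈ fromℕ a * fromℕ b + fromℕ c * fromℕ d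
    fromℕ-sum-of-products a b c d =
      trans (×-homo-+ 1# (a ℕ.* b) (c ℕ.* d)) (+-cong (×1-homo-* a b) (×1-homo-* c d))

  ⟦⟧-equal? : ∀ p q → Maybe (⟦ p ⟧ℤ ≈ ⟦ q ⟧ℤ)
  ⟦⟧-equal? (a , b) (c , d) with a ℕ.+ d ℕ.≟ c ℕ.+ b
  ... | yes a+d≡c+b = just (a+d≈c+b⇒a-b≈c-d (fromℕ a) (fromℕ b) (fromℕ c) (fromℕ d)
          (trans (sym (×-homo-+ 1# a d)) (trans (reflexive (≡.cong fromℕ a+d≡c+b)) (×-homo-+ 1# c b))))
  ... | no _ = nothing

  open import Algebra.Solver.Ring ℕ²-rawRing (fromCommutativeRing R) ⟦⟧-homomorphism ⟦⟧-equal? public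

module _ {r ℓr m ℓm : Level} {R : CommutativeRing r ℓr} (M : Module R m ℓm) where
  open CommutativeRing R
  open Module M
  open import Algebra.Module.Properties M using (inverseʳ-uniqueᴹ)

  -ᴹ‿distribˡ-*ₗ : ∀ k ψ → -ᴹ (k *ₗ ψ) ≈ᴹ (- k) *ₗ ψ
  -ᴹ‿distribˡ-*ₗ k ψ = ≈ᴹ-sym (inverseʳ-uniqueᴹ (k *ₗ ψ) ((- k) *ₗ ψ) kψ+[-k]ψ≈0)
    where
    kψ+[-k]ψ≈0 : (k *ₗ ψ) +ᴹ ((- k) *ₗ ψ) ≈ᴹ 0ᴹ
    kψ+[-k]ψ≈0 = ≈ᴹ-trans (≈ᴹ-sym (*ₗ-distribʳ ψ k (- k)))
                 (≈ᴹ-trans (*ₗ-congʳ (-‿inverseʳ k)) (*ₗ-zeroˡ ψ))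

module _ {c ℓ m ℓm : Level} (𝒜 : SuperCommAlgebra c ℓ m ℓm) where
  open SuperCommAlgebra 𝒜
  open OSp12 𝒜
  open Module odd
    using ( *ₗ-cong; *ₗ-congʳ; *ₗ-zeroˡ; *ₗ-zeroʳ; *ₗ-distribʳ; *ₗ-identityˡ; *ₗ-assoc
          ; +ᴹ-cong; +ᴹ-assoc; +ᴹ-identityˡ; +ᴹ-identityʳ; -ᴹ‿inverseˡ; -ᴹ‿cong
          ; ≈ᴹ-refl; ≈ᴹ-sym; ≈ᴹ-trans )
  open import Algebra.Properties.Ring ring using (-1*x≈-x; -0#≈0#)
  open IntegerCoefficientSolver even using (solve; _:=_; _:+_; _:*_; _:-_; :-_)

  0ᴹ·ψ≈0 : ∀ ψ → 0ᴹ · ψ ≈ 0#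
  0ᴹ·ψ≈0 ψ = begin
    0ᴹ · ψ            ≈⟨ ·-cong (*ₗ-zeroˡ 0ᴹ) ≈ᴹ-refl ⟨
    (0# *ₗ 0ᴹ) · ψ    ≈⟨ ·-scalarˡ 0# 0ᴹ ψ ⟩
    0# * (0ᴹ · ψ)     ≈⟨ zeroˡ _ ⟩
    0#                ∎
    where open import Relation.Binary.Reasoning.Setoid setoid

  *ₗ·*ₗ≈0 : ∀ a b β → (a *ₗ β) · (b *ₗ β) ≈ 0#
  *ₗ·*ₗ≈0 a b β = begin
    (a *ₗ β) · (b *ₗ β)   ≈⟨ ·-scalarˡ a β (b *ₗ β) ⟩
    a * (β · (b *ₗ β))    ≈⟨ *-congˡ (·-scalarʳ b β β) ⟩
    a * (b * (β · β))     ≈⟨ *-congˡ (*-congˡ (·-square β)) ⟩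
    a * (b * 0#)          ≈⟨ *-congˡ (zeroʳ b) ⟩
    a * 0#                ≈⟨ zeroʳ a ⟩
    0#                    ∎
    where open import Relation.Binary.Reasoning.Setoid setoid

  ≈M-trans : ∀ {M N O} → M ≈M N → N ≈M O → M ≈M O
  ≈M-trans (e₁ , e₂ , e₃ , e₄ , e₅ , e₆ , e₇ , e₈ , e₉) (f₁ , f₂ , f₃ , f₄ , f₅ , f₆ , f₇ , f₈ , f₉) =
    trans e₁ f₁ , trans e₂ f₂ , trans e₃ f₃ , trans e₄ f₄ , trans e₅ f₅ ,
    ≈ᴹ-trans e₆ f₆ , ≈ᴹ-trans e₇ f₇ , ≈ᴹ-trans e₈ f₈ , ≈ᴹ-trans e₉ f₉

  ⊙-congˡ : ∀ M {N N′} → N ≈M N′ → (M ⊙ N) ≈M (M ⊙ N′)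
  ⊙-congˡ M (e₁₁ , e₁₂ , e₂₁ , e₂₂ , eᵈ , eᵇ¹ , eᵇ² , eᶜ¹ , eᶜ²) =
      +-cong (+-cong (*-congˡ e₁₁) (*-congˡ e₂₁)) (·-cong ≈ᴹ-refl eᶜ¹)
    , +-cong (+-cong (*-congˡ e₁₂) (*-congˡ e₂₂)) (·-cong ≈ᴹ-refl eᶜ²)
    , +-cong (+-cong (*-congˡ e₁₁) (*-congˡ e₂₁)) (·-cong ≈ᴹ-refl eᶜ¹)
    , +-cong (+-cong (*-congˡ e₁₂) (*-congˡ e₂₂)) (·-cong ≈ᴹ-refl eᶜ²)
    , +-cong (+-cong (·-cong ≈ᴹ-refl eᵇ¹) (·-cong ≈ᴹ-refl eᵇ²)) (*-congˡ eᵈ)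
    , +ᴹ-cong (+ᴹ-cong (*ₗ-cong refl eᵇ¹) (*ₗ-cong refl eᵇ²)) (*ₗ-congʳ eᵈ)
    , +ᴹ-cong (+ᴹ-cong (*ₗ-cong refl eᵇ¹) (*ₗ-cong refl eᵇ²)) (*ₗ-congʳ eᵈ)
    , +ᴹ-cong (+ᴹ-cong (*ₗ-congʳ e₁₁) (*ₗ-congʳ e₂₁)) (*ₗ-cong refl eᶜ¹)
    , +ᴹ-cong (+ᴹ-cong (*ₗ-congʳ e₁₂) (*ₗ-congʳ e₂₂)) (*ₗ-cong refl eᶜ²)

  rotateRows : SMat → SMat
  rotateRows g = record
    { a11 = a21 g ; a12 = a22 g ; a21 = - a11 g ; a22 = - a12 g
    ; b1 = b2 g ; b2 = -ᴹ b1 g ; c1 = c1 g ; c2 = c2 g ; d = d g }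

  J⊙≈rotateRows : ∀ g → (J ⊙ g) ≈M rotateRows g
  J⊙≈rotateRows g =
      selectSecond (a11 g) (a21 g) (0ᴹ·ψ≈0 (c1 g))
    , selectSecond (a12 g) (a22 g) (0ᴹ·ψ≈0 (c2 g))
    , negateFirst (a11 g) (a21 g) (0ᴹ·ψ≈0 (c1 g))
    , negateFirst (a12 g) (a22 g) (0ᴹ·ψ≈0 (c2 g))
    , trans (+-cong (+-cong (0ᴹ·ψ≈0 (b1 g)) (0ᴹ·ψ≈0 (b2 g))) (*-identityˡ (d g)))
            (trans (+-congʳ (+-identityʳ 0#)) (+-identityˡ _))
    , ≈ᴹ-trans (+ᴹ-cong (+ᴹ-cong (*ₗ-zeroˡ (b1 g)) (*ₗ-identityˡ (b2 g))) (*ₗ-zeroʳ (d g)))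
               (≈ᴹ-trans (+ᴹ-identityʳ _) (+ᴹ-identityˡ _))
    , ≈ᴹ-trans (+ᴹ-cong (+ᴹ-cong [-1]ψ≈-ψ (*ₗ-zeroˡ (b2 g))) (*ₗ-zeroʳ (d g)))
               (≈ᴹ-trans (+ᴹ-identityʳ _) (+ᴹ-identityʳ _))
    , keepOdd (a11 g) (a21 g) (c1 g)
    , keepOdd (a12 g) (a22 g) (c2 g)
    where
    selectSecond : ∀ a b {e} → e ≈ 0# → 0# * a + 1# * b + e ≈ b
    selectSecond a b e≈0 = trans (+-cong (+-cong (zeroˡ a) (*-identityˡ b)) e≈0)
                                 (trans (+-identityʳ _) (+-identityˡ b))
    negateFirst : ∀ a b {e} → e ≈ 0# → (- 1#) * a + 0# * b + e ≈ - a
    negateFirst a b e≈0 = trans (+-cong (+-cong (-1*x≈-x a) (zeroˡ b)) e≈0)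
                                (trans (+-identityʳ _) (+-identityʳ _))
    [-1]ψ≈-ψ : (- 1#) *ₗ b1 g ≈ᴹ -ᴹ b1 g
    [-1]ψ≈-ψ = ≈ᴹ-trans (≈ᴹ-sym (-ᴹ‿distribˡ-*ₗ odd 1# (b1 g)))
                        (-ᴹ‿cong (*ₗ-identityˡ (b1 g)))
    keepOdd : ∀ a b χ → (a *ₗ 0ᴹ) +ᴹ (b *ₗ 0ᴹ) +ᴹ (1# *ₗ χ) ≈ᴹ χ
    keepOdd a b χ = ≈ᴹ-trans (+ᴹ-cong (+ᴹ-cong (*ₗ-zeroʳ a) (*ₗ-zeroʳ b)) (*ₗ-identityˡ χ))
                             (≈ᴹ-trans (+ᴹ-cong (+ᴹ-identityʳ 0ᴹ) ≈ᴹ-refl) (+ᴹ-identityˡ χ))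

  -- All odd entries are multiples of one odd β, so products of two of them vanish; the odd
  -- row (k₁ k₂) = (s t) J₀ A, J₀ the even block of J, is what the odd entries of g^st J g = J demand.
  module OddMultiples (a₁₁ a₁₂ a₂₁ a₂₂ s t : Carrier) (β : Carrierᴹ) where
    k₁ k₂ : Carrier
    k₁ = a₂₁ * s - a₁₁ * t
    k₂ = a₂₂ * s - a₁₂ * t

    matrix : SMat
    matrix = record
      { a11 = a₁₁ ; a12 = a₁₂ ; a21 = a₂₁ ; a22 = a₂₂
      ; b1 = s *ₗ β ; b2 = t *ₗ β ; c1 = k₁ *ₗ β ; c2 = k₂ *ₗ β ; d = 1# }

    Ber≈det : Ber matrix 1# ≈ a₁₁ * a₂₂ - a₁₂ * a₂₁
    Ber≈det = trans (*-identityʳ _)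
      (+-cong (*-cong (a-1*[kβ·lβ]≈a _ _ _) (a-1*[kβ·lβ]≈a _ _ _)) (-‿cong (*-cong (a-1*[kβ·lβ]≈a _ _ _) (a-1*[kβ·lβ]≈a _ _ _))))
      where
      a-1*[kβ·lβ]≈a : ∀ a k l → a - 1# * ((k *ₗ β) · (l *ₗ β)) ≈ a
      a-1*[kβ·lβ]≈a a k l = trans (+-congˡ (-‿cong (trans (*-identityˡ _) (*ₗ·*ₗ≈0 k l β))))
                         (trans (+-congˡ -0#≈0#) (+-identityʳ a))

    evenEntry : ∀ k l {a b e f r} → a * b + e * f ≈ r → a * b + e * f + (k *ₗ β) · (l *ₗ β) ≈ r
    evenEntry k l eq = trans (+-congˡ (*ₗ·*ₗ≈0 k l β)) (trans (+-identityʳ _) eq)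

    *ₗ-reassoc : ∀ a k → a *ₗ (k *ₗ β) ≈ᴹ (a * k) *ₗ β
    *ₗ-reassoc a k = ≈ᴹ-sym (*ₗ-assoc a k β)

    *ₗ-neg-reassoc : ∀ a k → a *ₗ (-ᴹ (k *ₗ β)) ≈ᴹ (a * - k) *ₗ β
    *ₗ-neg-reassoc a k = ≈ᴹ-trans (*ₗ-cong refl (-ᴹ‿distribˡ-*ₗ odd k β)) (*ₗ-reassoc a (- k))

    oddEntry : ∀ {ψ χ a b k} → ψ ≈ᴹ a *ₗ β → χ ≈ᴹ b *ₗ β → a + b + k ≈ 0# →
               ψ +ᴹ χ +ᴹ (1# *ₗ (k *ₗ β)) ≈ᴹ 0ᴹ
    oddEntry {k = k} ψ≈ χ≈ a+b+k≈0 =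
      ≈ᴹ-trans (+ᴹ-cong (+ᴹ-cong ψ≈ χ≈) (*ₗ-identityˡ (k *ₗ β)))
      (≈ᴹ-trans (+ᴹ-cong (≈ᴹ-sym (*ₗ-distribʳ β _ _)) ≈ᴹ-refl)
      (≈ᴹ-trans (≈ᴹ-sym (*ₗ-distribʳ β _ k))
      (≈ᴹ-trans (*ₗ-congʳ a+b+k≈0) (*ₗ-zeroˡ β))))

    oddColumnCoefficients≈0 : ∀ a b → a * t + b * - s + (b * s - a * t) ≈ 0#
    oddColumnCoefficients≈0 a b = trans
      (solve 4 (λ a b s t → a :* t :+ b :* (:- s) :+ (b :* s :- a :* t) := a :* t :- a :* t)
             refl a b s t)
      (-‿inverseʳ _)

    oddRowCoefficients≈0 : ∀ a b → b * - s + - a * - t + (b * s - a * t) ≈ 0#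
    oddRowCoefficients≈0 a b = trans
      (solve 4 (λ a b s t → b :* (:- s) :+ (:- a) :* (:- t) :+ (b :* s :- a :* t) := a :* t :- a :* t)
             refl a b s t)
      (-‿inverseʳ _)

    module _ (det≈1 : a₁₁ * a₂₂ - a₁₂ * a₂₁ ≈ 1#) where
      st⊙rotateRows≈J : (st matrix ⊙ rotateRows matrix) ≈M J
      st⊙rotateRows≈J =
          evenEntry k₁ k₁ (trans (solve 2 (λ a b → a :* b :+ b :* (:- a) := a :* b :- a :* b)
                                          refl a₁₁ a₂₁) (-‿inverseʳ _))
        , evenEntry k₁ k₂ (trans (solve 4 (λ a b c d → a :* d :+ c :* (:- b) := a :* d :- b :* c)
                                          refl a₁₁ a₁₂ a₂₁ a₂₂) det≈1)
        , evenEntry k₂ k₁ (trans (solve 4 (λ a b c d → b :* c :+ d :* (:- a) := :- (a :* d :- b :* c))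
                                          refl a₁₁ a₁₂ a₂₁ a₂₂) (-‿cong det≈1))
        , evenEntry k₂ k₂ (trans (solve 2 (λ a b → a :* b :+ b :* (:- a) := a :* b :- a :* b)
                                          refl a₁₂ a₂₂) (-‿inverseʳ _))
        , trans (+-cong (+-cong (trans (·-cong (-ᴹ‿distribˡ-*ₗ odd s β) ≈ᴹ-refl) (*ₗ·*ₗ≈0 _ _ β))
                                (trans (·-cong (-ᴹ‿distribˡ-*ₗ odd t β) (-ᴹ‿distribˡ-*ₗ odd s β))
                                       (*ₗ·*ₗ≈0 _ _ β)))
                        (*-identityˡ 1#))
                (trans (+-congʳ (+-identityʳ 0#)) (+-identityˡ 1#))
        , oddEntry (*ₗ-reassoc a₁₁ t) (*ₗ-neg-reassoc a₂₁ s) (oddColumnCoefficients≈0 a₁₁ a₂₁)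
        , oddEntry (*ₗ-reassoc a₁₂ t) (*ₗ-neg-reassoc a₂₂ s) (oddColumnCoefficients≈0 a₁₂ a₂₂)
        , oddEntry (*ₗ-neg-reassoc a₂₁ s) (*ₗ-neg-reassoc (- a₁₁) t) (oddRowCoefficients≈0 a₁₁ a₂₁)
        , oddEntry (*ₗ-neg-reassoc a₂₂ s) (*ₗ-neg-reassoc (- a₁₂) t) (oddRowCoefficients≈0 a₁₂ a₂₂)

      isOSp : IsOSp matrix
      isOSp = (1# , *-identityʳ 1# , trans Ber≈det det≈1)
            , ≈M-trans (⊙-congˡ (st matrix) (J⊙≈rotateRows matrix)) st⊙rotateRows≈J

  Unimodular : Carrier → Carrier → Set (c ⊔ ℓ)
  Unimodular x y = ∃₂ λ p q → p * x + q * y ≈ 1#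

  InPlus⇒Unimodular : ∀ v → InPlus v → Unimodular (vx v) (vy v)
  InPlus⇒Unimodular v (inj₁ (z , xz≈1)) =
    z , 0# , trans (+-cong (*-comm z (vx v)) (zeroˡ (vy v))) (trans (+-identityʳ _) xz≈1)
  InPlus⇒Unimodular v (inj₂ (w , yw≈1)) =
    0# , w , trans (+-cong (zeroˡ (vx v)) (*-comm w (vy v))) (trans (+-identityˡ _) yw≈1)

  -- A (x , y) = (v₁ , v₂) and A (q , −p) = (s , t), so det A = s v₂ − t v₁ = p′ x′ + q′ y′ = 1.
  transport : ∀ {x y x′ y′ φ φ′} p q p′ q′ → p * x + q * y ≈ 1# → p′ * x′ + q′ * y′ ≈ 1# →
              ∃[ g ] (IsOSp g × (g ▷ ⟨ x , y ∣ φ ⟩) ≈V ⟨ x′ , y′ ∣ φ′ ⟩)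
  transport {x} {y} {x′} {y′} {φ} {φ′} p q p′ q′ px+qy≈1 p′x′+q′y′≈1 =
    matrix , isOSp det≈1 , (evenRow s x′ , evenRow t y′ , oddRow)
    where
    s t E v₁ v₂ : Carrier
    s = q′
    t = - p′
    β : Carrierᴹ
    β = φ′ +ᴹ -ᴹ φ
    E = β · φ
    v₁ = x′ - s * E
    v₂ = y′ - t * E
    open OddMultiples (p * v₁ + s * y) (q * v₁ - s * x) (p * v₂ + t * y) (q * v₂ - t * x) s t β

    sv₂-tv₁≈1 : s * v₂ - t * v₁ ≈ 1#
    sv₂-tv₁≈1 = trans
      (solve 5 (λ p′ q′ x′ y′ E → q′ :* (y′ :- (:- p′) :* E) :- (:- p′) :* (x′ :- q′ :* E)
                                  := p′ :* x′ :+ q′ :* y′) refl p′ q′ x′ y′ E)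
      p′x′+q′y′≈1

    det≈1 : (p * v₁ + s * y) * (q * v₂ - t * x) - (q * v₁ - s * x) * (p * v₂ + t * y) ≈ 1#
    det≈1 = trans
      (solve 8 (λ p q s t x y v₁ v₂ →
                  (p :* v₁ :+ s :* y) :* (q :* v₂ :- t :* x) :- (q :* v₁ :- s :* x) :* (p :* v₂ :+ t :* y)
                  := (p :* x :+ q :* y) :* (s :* v₂ :- t :* v₁)) refl p q s t x y v₁ v₂)
      (trans (*-cong px+qy≈1 sv₂-tv₁≈1) (*-identityˡ 1#))

    evenRow : ∀ r w → (p * (w - r * E) + r * y) * x + (q * (w - r * E) - r * x) * y + (r *ₗ β) · φ ≈ w
    evenRow r w = trans (+-congˡ (·-scalarˡ r β φ)) (trans
      (solve 7 (λ p q r x y w E → (p :* (w :- r :* E) :+ r :* y) :* x :+ (q :* (w :- r :* E) :- r :* x) :* y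
                                   :+ r :* E := (p :* x :+ q :* y) :* (w :- r :* E) :+ r :* E)
             refl p q r x y w E)
      (trans (+-congʳ (trans (*-congʳ px+qy≈1) (*-identityˡ _)))
             (solve 3 (λ w r E → (w :- r :* E) :+ r :* E := w) refl w r E)))

    xk₁+yk₂≈1 : x * k₁ + y * k₂ ≈ 1#
    xk₁+yk₂≈1 = trans
      (solve 8 (λ p q s t x y v₁ v₂ →
                  x :* ((p :* v₂ :+ t :* y) :* s :- (p :* v₁ :+ s :* y) :* t)
                  :+ y :* ((q :* v₂ :- t :* x) :* s :- (q :* v₁ :- s :* x) :* t)
                  := (s :* v₂ :- t :* v₁) :* (p :* x :+ q :* y)) refl p q s t x y v₁ v₂)
      (trans (*-cong sv₂-tv₁≈1 px+qy≈1) (*-identityˡ 1#))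

    oddRow : (x *ₗ (k₁ *ₗ β)) +ᴹ (y *ₗ (k₂ *ₗ β)) +ᴹ (1# *ₗ φ) ≈ᴹ φ′
    oddRow = begin
      (x *ₗ (k₁ *ₗ β)) +ᴹ (y *ₗ (k₂ *ₗ β)) +ᴹ (1# *ₗ φ)
        ≈⟨ +ᴹ-cong (+ᴹ-cong (≈ᴹ-sym (*ₗ-assoc x k₁ β)) (≈ᴹ-sym (*ₗ-assoc y k₂ β))) (*ₗ-identityˡ φ) ⟩
      ((x * k₁) *ₗ β) +ᴹ ((y * k₂) *ₗ β) +ᴹ φ
        ≈⟨ +ᴹ-cong (≈ᴹ-sym (*ₗ-distribʳ β (x * k₁) (y * k₂))) ≈ᴹ-refl ⟩
      ((x * k₁ + y * k₂) *ₗ β) +ᴹ φ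
        ≈⟨ +ᴹ-cong (≈ᴹ-trans (*ₗ-congʳ xk₁+yk₂≈1) (*ₗ-identityˡ β)) ≈ᴹ-refl ⟩
      (φ′ +ᴹ -ᴹ φ) +ᴹ φ    ≈⟨ +ᴹ-assoc φ′ (-ᴹ φ) φ ⟩
      φ′ +ᴹ (-ᴹ φ +ᴹ φ)    ≈⟨ +ᴹ-cong ≈ᴹ-refl (-ᴹ‿inverseˡ φ) ⟩
      φ′ +ᴹ 0ᴹ             ≈⟨ +ᴹ-identityʳ φ′ ⟩
      φ′                   ∎
      where open import Relation.Binary.Reasoning.Setoid (Module.≈ᴹ-setoid odd)

corollary7p8 : ∀ {c ℓ m ℓm : Level} (𝒜 : SuperCommAlgebra c ℓ m ℓm) →
    OSp12.TransitiveOnPlus 𝒜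
corollary7p8 𝒜 u v u₊ v₊ with InPlus⇒Unimodular 𝒜 u u₊ | InPlus⇒Unimodular 𝒜 v v₊
... | p , q , px+qy≈1 | p′ , q′ , p′x′+q′y′≈1 = transport 𝒜 p q p′ q′ px+qy≈1 p′x′+q′y′≈1
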